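{- Let $\mathcal{C}$ be a graph class and $r\ge1$ such that for every $k\in\mathbb{N}$, some graph in $\mathcal{C}$ contains as an induced subgraph a flipped star $r$-crossing of order $k$, or a flipped clique $r$-crossing of order $k$, or a flipped half-graph $r$-crossing of order $k$, or a comparability grid of order $k$. Then $\mathcal{C}$ is monadically independent.
   Context: Flips: for a graph $G$, partition $\mathcal{K}$ of $V(G)$ and symmetric $F\subseteq\mathcal{K}^2$, $G\oplus_{\mathcal{K}}F$ is the graph on $V(G)$ where distinct $u,v$ are adjacent iff exactly one of "$uv\in E(G)$" and "$(\mathcal{K}(u),\mathcal{K}(v))\in F$" holds. Crossings: for $r,n\ge1$, the star $r$-crossing of order $n$ has vertices $a_1,\dots,a_n,b_1,\dots,b_n,p_{i,j,t}$ ($i,j\in[n],t\in[r]$), where for each $i,j$ the vertices $a_i,p_{i,j,1},\dots,p_{i,j,r},b_j$ form a path, and no other edges. The clique $r$-crossing additionally has edges $p_{i,j,1}p_{i,j',1}$ ($j\ne j'$) and $p_{i,j,r}p_{i',j,r}$ ($i\ne i'$). The half-graph $r$-crossing is like the star $r$-crossing except $a_i$ is adjacent to $p_{i',j,1}$ for all $i\le i'$, all $j$, and $b_j$ to $p_{i,j',r}$ for all $i$ and $j\le j'$. Layers: $L_0=\{a_i\}$, $L_t=\{p_{i,j,t}\}$, $L_{r+1}=\{b_j\}$. A flipped crossing is $H\oplus_{\mathcal{L}}F$ for such a crossing $H$, the layer partition $\mathcal{L}$ and any symmetric $F\subseteq\mathcal{L}^2$. The comparability grid of order $n$ has vertices $a_{i,j}$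 ($i,j\in[n]$), distinct $a_{i,j},a_{i',j'}$ adjacent iff $i=i'$ or $j=j'$ or ($i<i'\Leftrightarrow j<j'$). Monadic independence: $\mathcal{C}$ transduces $\mathcal{D}$ if there is a first-order formula $\varphi(x,y)$ over graphs with finitely many extra unary predicates such that every graph in $\mathcal{D}$ arises from some $G\in\mathcal{C}$ by coloring vertices to get $G^+$, replacing the edge set by $\{uv:u\ne v,G^+\models\varphi(u,v)\vee\varphi(v,u)\}$ and taking an induced subgraph; $\mathcal{C}$ is monadically independent if it transduces the class of all finite graphs. -}

module Defs where

open import Data.Bool using (Bool; true; false; _∧_; _∨_; not; _xor_)
open import Data.Nat using (ℕ; zero; suc; _≡ᵇ_; _≤ᵇ_; _<ᵇ_)
open import Data.Fin using (Fin; zero; suc; toℕ; inject₁; fromℕ)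
open import Data.List using (List; allFin)
open import Data.Bool.ListAction using (any; all)
open import Data.Product using (Σ; ∃; _×_; _,_)
open import Data.Sum using (_⊎_)
open import Data.Unit using (⊤)
open import Relation.Binary.PropositionalEquality using (_≡_)
open import Relation.Nullary using (¬_)

record Graph : Set where
  field
    V     : ℕ
    adj   : Fin V → Fin V → Bool
    sym   : ∀ u v → adj u v ≡ adj v u
    irrefl : ∀ u → adj u u ≡ false
open Graph public

GraphClass : Set₁
GraphClass = Graph → Set

-- G contains as an induced subgraph the (simple) graph with vertex type W
-- and adjacency relation a (only consulted on distinct vertices):
-- there is an injective embedding preserving adjacency and non-adjacency.
EmbedsInduced : (N : ℕ) (A : Fin N → Fin N → Bool) (W : Set) (a : W → W → Bool) → Set
EmbedsInduced N A W a =
  Σ (W → Fin N) λ e →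
    (∀ u v → e u ≡ e v → u ≡ v) ×
    (∀ u v → ¬ (u ≡ v) → A (e u) (e v) ≡ a u v)

ContainsInduced : (G : Graph) (W : Set) (a : W → W → Bool) → Set
ContainsInduced G = EmbedsInduced (V G) (adj G)

-- vertices: a i, b j, p i j t  (t : Fin r encodes the index t+1 ∈ [r])
data CrossV (n r : ℕ) : Set where
  a : Fin n → CrossV n r
  b : Fin n → CrossV n r
  p : Fin n → Fin n → Fin r → CrossV n r

_==_ : ∀ {n} → Fin n → Fin n → Bool
i == j = toℕ i ≡ᵇ toℕ j

_<=_ : ∀ {n} → Fin n → Fin n → Bool
i <= j = toℕ i ≤ᵇ toℕ j

_<<_ : ∀ {n} → Fin n → Fin n → Bool
i << j = toℕ i <ᵇ toℕ j

isFirst : ∀ {r} → Fin r → Bool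
isFirst t = toℕ t ≡ᵇ 0

isLast : ∀ {r} → Fin r → Bool
isLast {r} t = suc (toℕ t) ≡ᵇ r

pathE : ∀ {n r} → Fin n → Fin n → Fin r → Fin n → Fin n → Fin r → Bool
pathE i j t i' j' t' = (i == i') ∧ (j == j') ∧ (suc (toℕ t) ≡ᵇ toℕ t')

-- directed versions of the edge relations; the adjacency is their symmetrisation
starE : ∀ {n r} → CrossV n r → CrossV n r → Bool
starE (a i) (p i' j t) = (i == i') ∧ isFirst t
starE (p i j t) (p i' j' t') = pathE i j t i' j' t'
starE (p i j t) (b j') = (j == j') ∧ isLast t
starE _ _ = false

cliqueE : ∀ {n r} → CrossV n r → CrossV n r → Bool
cliqueE (p i j t) (p i' j' t') =
  pathE i j t i' j' t'
  ∨ (isFirst t ∧ isFirst t' ∧ (i == i') ∧ not (j == j'))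
  ∨ (isLast t ∧ isLast t' ∧ (j == j') ∧ not (i == i'))
cliqueE u v = starE u v

halfE : ∀ {n r} → CrossV n r → CrossV n r → Bool
halfE (a i) (p i' j t) = (i <= i') ∧ isFirst t
halfE (p i j' t) (b j) = (j <= j') ∧ isLast t
halfE u v = starE u v

symm : ∀ {W : Set} → (W → W → Bool) → W → W → Bool
symm e u v = e u v ∨ e v u

starCrossing cliqueCrossing halfCrossing :
  ∀ n r → CrossV n r → CrossV n r → Bool
starCrossing n r = symm starE
cliqueCrossing n r = symm cliqueE
halfCrossing n r = symm halfE

-- layer partition: L_0 = {a_i}, L_t = {p_{i,j,t}}, L_{r+1} = {b_j}
layer : ∀ {n r} → CrossV n r → Fin (suc (suc r))
layer (a _) = zero
layer {r = r} (b _) = fromℕ (suc r)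
layer (p _ _ t) = suc (inject₁ t)

flipLayers : ∀ {n r} → (F : Fin (suc (suc r)) → Fin (suc (suc r)) → Bool) →
  (CrossV n r → CrossV n r → Bool) → CrossV n r → CrossV n r → Bool
flipLayers F e u v = e u v xor F (layer u) (layer v)

SymmetricF : ∀ {r} → (Fin r → Fin r → Bool) → Set
SymmetricF F = ∀ x y → F x y ≡ F y x

ContainsFlipped : (Graph) → (n r : ℕ) → (CrossV n r → CrossV n r → Bool) → Set
ContainsFlipped G n r e =
  Σ (Fin (suc (suc r)) → Fin (suc (suc r)) → Bool) λ F →
    SymmetricF F × ContainsInduced G (CrossV n r) (flipLayers F e)

_⇔ᵇ_ : Bool → Bool → Bool
x ⇔ᵇ y = not (x xor y)

gridAdj : ∀ n → (Fin n × Fin n) → (Fin n × Fin n) → Bool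
gridAdj n (i , j) (i' , j') = (i == i') ∨ (j == j') ∨ ((i << i') ⇔ᵇ (j << j'))

data Formula (m : ℕ) : ℕ → Set where
  edge   : ∀ {k} → Fin k → Fin k → Formula m k
  equal  : ∀ {k} → Fin k → Fin k → Formula m k
  pred   : ∀ {k} → Fin m → Fin k → Formula m k
  ⊤f ⊥f  : ∀ {k} → Formula m k
  ¬f_    : ∀ {k} → Formula m k → Formula m k
  _∧f_ _∨f_ : ∀ {k} → Formula m k → Formula m k → Formula m k
  ∃f ∀f  : ∀ {k} → Formula m (suc k) → Formula m k

extend : ∀ {k} {A : Set} → A → (Fin k → A) → Fin (suc k) → A
extend x ρ zero = x
extend x ρ (suc i) = ρ i

eval : ∀ {m k} (G : Graph) (P : Fin m → Fin (V G) → Bool) →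
  (Fin k → Fin (V G)) → Formula m k → Bool
eval G P ρ (edge i j) = adj G (ρ i) (ρ j)
eval G P ρ (equal i j) = ρ i == ρ j
eval G P ρ (pred c i) = P c (ρ i)
eval G P ρ ⊤f = true
eval G P ρ ⊥f = false
eval G P ρ (¬f φ) = not (eval G P ρ φ)
eval G P ρ (φ ∧f ψ) = eval G P ρ φ ∧ eval G P ρ ψ
eval G P ρ (φ ∨f ψ) = eval G P ρ φ ∨ eval G P ρ ψ
eval G P ρ (∃f φ) = any (λ x → eval G P (extend x ρ) φ) (allFin (V G))
eval G P ρ (∀f φ) = all (λ x → eval G P (extend x ρ) φ) (allFin (V G))

pair : ∀ {A : Set} → A → A → Fin 2 → A
pair x y zero = x
pair x y (suc _) = y

Transduces : GraphClass → GraphClass → Set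
Transduces 𝒞 𝒟 =
  Σ ℕ λ m → Σ (Formula m 2) λ φ →
    ∀ H → 𝒟 H →
      Σ Graph λ G → 𝒞 G ×
        Σ (Fin m → Fin (V G) → Bool) λ P →
          EmbedsInduced (V G)
            (λ u v → eval G P (pair u v) φ ∨ eval G P (pair v u) φ)
            (Fin (V H)) (adj H)

AllGraphs : GraphClass
AllGraphs _ = ⊤

MonadicallyIndependent : GraphClass → Set
MonadicallyIndependent 𝒞 = Transduces 𝒞 AllGraphs

ContainsPattern : Graph → (r k : ℕ) → Set
ContainsPattern G r k =
  ContainsFlipped G k r (starCrossing k r)
  ⊎ ContainsFlipped G k r (cliqueCrossing k r)
  ⊎ ContainsFlipped G k r (halfCrossing k r)
  ⊎ ContainsInduced G (Fin k × Fin k) (gridAdj k)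

-- Each graph H is defined, by one formula for all H, in a coloured pattern of order |V H| + 1.
-- The pattern supplies a grid of witnesses w u v; H sits on the diagonal, a colour M marks the
-- witnesses w u v with uv an edge of H, and φ(x , y) = ∃ z. M z ∧ row(z , x) ∧ col(z , y), where
-- row and col hold between two witnesses exactly when they lie in the same row, resp. column.
-- In a comparability grid, row and column 0 are markers: the markers adjacent to a witness are
-- those below its position, which determines it.  In a flipped r-crossing the witnesses are the
-- p_{i,j,1}; the a_l mark rows, and the column is carried along the paths p_{i,j,1} … p_{i,j,r} to
-- layer r, where the b_l mark it.  A colour records which layer pairs are flipped, so the formula
-- can undo the flip and follow a path; clique and half-graph edges never join consecutive layers.
-- The formula is the disjunction of the grid and the crossing version, the unused one having an
-- empty M colour.

module Submission where

open import Defs hiding (sym)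
open import Data.Nat using (ℕ; _≤_)
open import Data.Product using (Σ; _×_)

open import Data.Bool using (Bool; true; false; _∧_; _∨_; not; _xor_; T)
open import Data.Bool.Properties
  using (T-∧; T-∨; T-≡; ∧-identityʳ; ∧-zeroʳ; ∨-identityʳ; ∨-idem; not-involutive;
         xor-assoc; xor-same; xor-identityʳ)
open import Data.Bool.ListAction using (any; all; or; and)
open import Data.Empty using (⊥; ⊥-elim)
open import Data.Fin as Fin using (Fin; zero; suc; toℕ; #_; inject₁; fromℕ; _↑ʳ_)
open import Data.Fin.Properties as Fin
  using (toℕ-injective; suc-injective; inject₁-injective; any?; _≟_;
         toℕ-inject₁; toℕ-inject₁-≢; toℕ-fromℕ)
open import Data.List using (allFin)
open import Data.List.Properties using (map-cong)
open import Data.List.Relation.Unary.All.Properties as All using (all⁺; all⁻)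
open import Data.List.Relation.Unary.Any.Properties as Any using (any⁺; any⁻)
import Data.Nat as ℕ
open import Data.Nat.Properties as ℕ
  using (≡ᵇ⇒≡; ≡⇒≡ᵇ; ≤ᵇ⇒≤; ≤⇒≤ᵇ; <ᵇ⇒<; <⇒<ᵇ; m≢1+n+m; 1+n≢n; m≤n⇒m<n∨m≡n)
open import Data.Product using (∃; ∃₂; _,_; proj₂)
open import Data.Product.Function.NonDependent.Propositional using (_×-⇔_)
open import Data.Sum using (_⊎_; inj₁; inj₂; [_,_])
open import Data.Sum.Function.Propositional using (_⊎-⇔_)
open import Data.Unit using (⊤; tt)
open import Data.Vec.Functional using (_∷_)
open import Function using (_∘_; flip)
open import Function.Bundles using (_⇔_; mk⇔; Equivalence)
open import Function.Related.TypeIsomorphisms using (¬-cong-⇔)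
import Function.Properties.Equivalence as ⇔
open import Relation.Binary.Core using (Rel)
open import Relation.Binary.Definitions using (Reflexive; Antisymmetric)
open import Relation.Binary.PropositionalEquality
  using (_≡_; refl; sym; trans; cong; cong₂; subst; subst₂; module ≡-Reasoning)
open import Relation.Nullary using (¬_; Dec; _×-dec_)
open import Relation.Nullary.Decidable using (isYes; toWitness; fromWitness; T?)

open Equivalence

T-cong : ∀ {x y} → x ≡ y → T x ⇔ T y
T-cong refl = ⇔.refl

T-injective : ∀ {x y} → T x ⇔ T y → x ≡ y
T-injective {false} {false} _ = refl
T-injective {false} {true} x⇔y = ⊥-elim (from x⇔y tt)
T-injective {true} {false} x⇔y = ⊥-elim (to x⇔y tt)
T-injective {true} {true} _ = refl

T-not : ∀ {x} → T (not x) ⇔ (¬ T x)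
T-not {false} = mk⇔ (λ _ ()) (λ _ → tt)
T-not {true} = mk⇔ (λ ()) (λ ¬t → ¬t tt)

¬T⇒≡false : ∀ {x} → ¬ T x → x ≡ false
¬T⇒≡false {false} _ = refl
¬T⇒≡false {true} ¬t = ⊥-elim (¬t tt)

T-not-xor : ∀ x y → T (not (x xor y)) ⇔ (x ≡ y)
T-not-xor false false = mk⇔ (λ _ → refl) (λ _ → tt)
T-not-xor false true = mk⇔ (λ ()) (λ ())
T-not-xor true false = mk⇔ (λ ()) (λ ())
T-not-xor true true = mk⇔ (λ _ → refl) (λ _ → tt)

T-not-∨-not-xor : ∀ x y z → T (not x ∨ not (y xor z)) ⇔ (T x → y ≡ z)
T-not-∨-not-xor false y z = mk⇔ (λ _ ()) (λ _ → tt)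
T-not-∨-not-xor true y z = ⇔.trans (T-not-xor y z) (mk⇔ (λ y≡z _ → y≡z) (λ y≡z → y≡z tt))

xor-dnf : ∀ x y → (x ∧ not y) ∨ (not x ∧ y) ≡ x xor y
xor-dnf false y = refl
xor-dnf true false = refl
xor-dnf true true = refl

not-xor-true : ∀ x → not (x xor true) ≡ x
not-xor-true false = refl
not-xor-true true = refl

xor-twice : ∀ x y → (x xor y) xor y ≡ x
xor-twice x y = begin
  (x xor y) xor y ≡⟨ xor-assoc x y y ⟩
  x xor (y xor y) ≡⟨ cong (x xor_) (xor-same y) ⟩
  x xor false     ≡⟨ xor-identityʳ x ⟩
  x               ∎
  where open ≡-Reasoning

xor-cancelʳ : ∀ {x y} z → x xor z ≡ y xor z → x ≡ y
xor-cancelʳ {x} {y} z eq = begin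
  x               ≡⟨ xor-twice x z ⟨
  (x xor z) xor z ≡⟨ cong (_xor z) eq ⟩
  (y xor z) xor z ≡⟨ xor-twice y z ⟩
  y               ∎
  where open ≡-Reasoning

T-∧true∨false : ∀ {x} → T ((x ∧ true) ∨ false) ⇔ T x
T-∧true∨false {x} = T-cong (trans (∨-identityʳ _) (∧-identityʳ x))

T-any-allFin : ∀ {n} (f : Fin n → Bool) → T (any f (allFin n)) ⇔ ∃ (T ∘ f)
T-any-allFin f = mk⇔ (Any.tabulate⁻ ∘ any⁻ f _) (λ (i , t) → any⁺ f (Any.tabulate⁺ i t))

T-all-allFin : ∀ {n} (f : Fin n → Bool) → T (all f (allFin n)) ⇔ (∀ i → T (f i))
T-all-allFin f = mk⇔ (All.tabulate⁻ ∘ all⁺ f _) (all⁻ f ∘ All.tabulate⁺)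

T-== : ∀ {n} {i j : Fin n} → T (i == j) ⇔ (i ≡ j)
T-== {i = i} {j} =
  mk⇔ (toℕ-injective ∘ ≡ᵇ⇒≡ (toℕ i) (toℕ j)) (≡⇒≡ᵇ (toℕ i) (toℕ j) ∘ cong toℕ)

T-<= : ∀ {n} {i j : Fin n} → T (i <= j) ⇔ (i Fin.≤ j)
T-<= {i = i} {j} = mk⇔ (≤ᵇ⇒≤ (toℕ i) (toℕ j)) ≤⇒≤ᵇ

T-==∨<< : ∀ {n} {i j : Fin n} → T ((i == j) ∨ (i << j)) ⇔ (i Fin.≤ j)
T-==∨<< {i = i} {j} = ⇔.trans T-∨ (mk⇔
  [ Fin.≤-reflexive ∘ to T-== , ℕ.<⇒≤ ∘ <ᵇ⇒< (toℕ i) (toℕ j) ]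
  (λ i≤j → [ inj₂ ∘ <⇒<ᵇ , inj₁ ∘ from T-== ∘ toℕ-injective ] (m≤n⇒m<n∨m≡n i≤j)))

∀-⇔ : {A : Set} {B C : A → Set} → (∀ x → B x ⇔ C x) → (∀ x → B x) ⇔ (∀ x → C x)
∀-⇔ B⇔C = mk⇔ (λ b x → to (B⇔C x) (b x)) (λ c x → from (B⇔C x) (c x))

markers-separate : ∀ {ℓ} {A : Set} {R : Rel A ℓ} → Reflexive R → Antisymmetric _≡_ R →
  (mark : A → A → Bool) → (∀ t x → T (mark t x) ⇔ R t x) →
  ∀ {x y} → (∀ t → mark t x ≡ mark t y) → x ≡ y
markers-separate {R = R} R-refl R-antisym mark spec {x} {y} agree =
  R-antisym (marked-by x y (agree x)) (marked-by y x (sym (agree y)))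
  where
  marked-by : ∀ t u → mark t t ≡ mark t u → R t u
  marked-by t u eq = to (spec t u) (subst T eq (from (spec t t) R-refl))

module _ (G : Graph) {m : ℕ} (P : Fin m → Fin (V G) → Bool) where

  Sat : ∀ {k} → (Fin k → Fin (V G)) → Formula m k → Set
  Sat ρ (edge i j) = T (adj G (ρ i) (ρ j))
  Sat ρ (equal i j) = ρ i ≡ ρ j
  Sat ρ (pred c i) = T (P c (ρ i))
  Sat ρ ⊤f = ⊤
  Sat ρ ⊥f = ⊥
  Sat ρ (¬f φ) = ¬ Sat ρ φ
  Sat ρ (φ ∧f ψ) = Sat ρ φ × Sat ρ ψ
  Sat ρ (φ ∨f ψ) = Sat ρ φ ⊎ Sat ρ ψ
  Sat ρ (∃f φ) = ∃ λ x → Sat (extend x ρ) φ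
  Sat ρ (∀f φ) = ∀ x → Sat (extend x ρ) φ

  eval-sound : ∀ {k} (ρ : Fin k → Fin (V G)) φ → T (eval G P ρ φ) ⇔ Sat ρ φ
  eval-sound ρ (edge i j) = ⇔.refl
  eval-sound ρ (equal i j) = T-==
  eval-sound ρ (pred c i) = ⇔.refl
  eval-sound ρ ⊤f = ⇔.refl
  eval-sound ρ ⊥f = ⇔.refl
  eval-sound ρ (¬f φ) = ⇔.trans T-not (¬-cong-⇔ (eval-sound ρ φ))
  eval-sound ρ (φ ∧f ψ) = ⇔.trans T-∧ (eval-sound ρ φ ×-⇔ eval-sound ρ ψ)
  eval-sound ρ (φ ∨f ψ) = ⇔.trans T-∨ (eval-sound ρ φ ⊎-⇔ eval-sound ρ ψ)
  eval-sound ρ (∃f φ) = ⇔.trans (T-any-allFin _)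
    (mk⇔ (λ (x , t) → x , to (eval-sound (extend x ρ) φ) t)
         (λ (x , s) → x , from (eval-sound (extend x ρ) φ) s))
  eval-sound ρ (∀f φ) = ⇔.trans (T-all-allFin _)
    (mk⇔ (λ t x → to (eval-sound (extend x ρ) φ) (t x))
         (λ s x → from (eval-sound (extend x ρ) φ) (s x)))

rename : ∀ {m k l} → (Fin k → Fin l) → Formula m k → Formula m l
rename σ (edge i j) = edge (σ i) (σ j)
rename σ (equal i j) = equal (σ i) (σ j)
rename σ (pred c i) = pred c (σ i)
rename σ ⊤f = ⊤f
rename σ ⊥f = ⊥f
rename σ (¬f φ) = ¬f rename σ φ
rename σ (φ ∧f ψ) = rename σ φ ∧f rename σ ψ
rename σ (φ ∨f ψ) = rename σ φ ∨f rename σ ψ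
rename σ (∃f φ) = ∃f (rename (Fin.lift 1 σ) φ)
rename σ (∀f φ) = ∀f (rename (Fin.lift 1 σ) φ)

infix 25 _⟨_,_⟩ _⊕f_

_⟨_,_⟩ : ∀ {m k} → Formula m 2 → Fin k → Fin k → Formula m k
φ ⟨ x , y ⟩ = rename (pair x y) φ

_⊕f_ : ∀ {m k} → Formula m k → Formula m k → Formula m k
φ ⊕f ψ = (φ ∧f (¬f ψ)) ∨f ((¬f φ) ∧f ψ)

extend-lift : ∀ {k l} {A : Set} (x : A) {σ : Fin k → Fin l} {ρ : Fin l → A} {ρ′ : Fin k → A} →
  (∀ i → ρ (σ i) ≡ ρ′ i) → ∀ i → extend x ρ (Fin.lift 1 σ i) ≡ extend x ρ′ i
extend-lift x ρσ≗ρ′ zero = refl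
extend-lift x ρσ≗ρ′ (suc i) = ρσ≗ρ′ i

module _ (G : Graph) {m : ℕ} (P : Fin m → Fin (V G) → Bool) where

  eval-rename : ∀ {k l} φ {σ : Fin k → Fin l} {ρ ρ′} → (∀ i → ρ (σ i) ≡ ρ′ i) →
    eval G P ρ (rename σ φ) ≡ eval G P ρ′ φ
  eval-rename (edge i j) ρσ≗ρ′ = cong₂ (adj G) (ρσ≗ρ′ i) (ρσ≗ρ′ j)
  eval-rename (equal i j) ρσ≗ρ′ = cong₂ _==_ (ρσ≗ρ′ i) (ρσ≗ρ′ j)
  eval-rename (pred c i) ρσ≗ρ′ = cong (P c) (ρσ≗ρ′ i)
  eval-rename ⊤f ρσ≗ρ′ = refl
  eval-rename ⊥f ρσ≗ρ′ = refl
  eval-rename (¬f φ) ρσ≗ρ′ = cong not (eval-rename φ ρσ≗ρ′)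
  eval-rename (φ ∧f ψ) ρσ≗ρ′ = cong₂ _∧_ (eval-rename φ ρσ≗ρ′) (eval-rename ψ ρσ≗ρ′)
  eval-rename (φ ∨f ψ) ρσ≗ρ′ = cong₂ _∨_ (eval-rename φ ρσ≗ρ′) (eval-rename ψ ρσ≗ρ′)
  eval-rename (∃f φ) {σ} {ρ} {ρ′} ρσ≗ρ′ = cong or (map-cong
    (λ x → eval-rename φ {Fin.lift 1 σ} {extend x ρ} {extend x ρ′} (extend-lift x ρσ≗ρ′)) (allFin _))
  eval-rename (∀f φ) {σ} {ρ} {ρ′} ρσ≗ρ′ = cong and (map-cong
    (λ x → eval-rename φ {Fin.lift 1 σ} {extend x ρ} {extend x ρ′} (extend-lift x ρσ≗ρ′)) (allFin _))

  sat-⟨⟩ : ∀ {k} (ρ : Fin k → Fin (V G)) φ x y →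
    Sat G P ρ (φ ⟨ x , y ⟩) ⇔ Sat G P (pair (ρ x) (ρ y)) φ
  sat-⟨⟩ ρ φ x y = ⇔.trans (⇔.sym (eval-sound G P ρ (φ ⟨ x , y ⟩)))
    (⇔.trans (T-cong (eval-rename φ λ { zero → refl ; (suc _) → refl })) (eval-sound G P _ φ))

  eval-⊕ : ∀ {k} (ρ : Fin k → Fin (V G)) φ ψ → eval G P ρ (φ ⊕f ψ) ≡ eval G P ρ φ xor eval G P ρ ψ
  eval-⊕ ρ φ ψ = xor-dnf (eval G P ρ φ) (eval G P ρ ψ)

SameNbhd : (G : Graph) → (Fin (V G) → Bool) → Fin (V G) → Fin (V G) → Set
SameNbhd G Q x y = ∀ w → T (Q w) → adj G w x ≡ adj G w y

-- K x will record whether the edges from the layer of x to the next one are flipped.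
Step : (G : Graph) → (Fin (V G) → Bool) → Fin (V G) → Fin (V G) → Set
Step G K x y = T (adj G x y xor K x)

agreeIfMarked : ∀ {m} → Fin m → Formula m 3
agreeIfMarked c = (¬f pred c (# 0)) ∨f (¬f (edge (# 0) (# 1) ⊕f edge (# 0) (# 2)))

same : ∀ {m} → Fin m → Formula m 2
same c = ∀f (agreeIfMarked c)

step : ∀ {m} → Fin m → Formula m 2
step c = edge (# 0) (# 1) ⊕f pred c (# 0)

module _ (G : Graph) {m : ℕ} (P : Fin m → Fin (V G) → Bool) where

  sat-same : ∀ c x y → Sat G P (pair x y) (same c) ⇔ SameNbhd G (P c) x y
  sat-same c x y = ∀-⇔ agrees
    where
    agrees : ∀ w → Sat G P (extend w (pair x y)) (agreeIfMarked c) ⇔ (T (P c w) → adj G w x ≡ adj G w y)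
    agrees w = ⇔.trans (⇔.sym (eval-sound G P ρ (agreeIfMarked c))) (⇔.trans
      (T-cong (cong (λ b → not (P c w) ∨ not b) (eval-⊕ G P ρ (edge (# 0) (# 1)) (edge (# 0) (# 2)))))
      (T-not-∨-not-xor (P c w) (adj G w x) (adj G w y)))
      where
      ρ = extend w (pair x y)

  sat-step : ∀ c x y → Sat G P (pair x y) (step c) ⇔ Step G (P c) x y
  sat-step c x y = ⇔.trans (⇔.sym (eval-sound G P (pair x y) (step c)))
    (T-cong (eval-⊕ G P (pair x y) (edge (# 0) (# 1)) (pred c (# 0))))

colour : {A : Set} {Q : A → Set} → (∀ x → Dec (Q x)) → A → Bool
colour Q? x = isYes (Q? x)

T-colour : {A : Set} {Q : A → Set} (Q? : ∀ x → Dec (Q x)) {x : A} → T (colour Q? x) ⇔ Q x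
T-colour Q? {x} = mk⇔ (toWitness {a? = Q? x}) (fromWitness {a? = Q? x})

image? : ∀ {n N} (f : Fin n → Fin N) g → Dec (∃ λ l → f l ≡ g)
image? f g = any? (λ l → f l ≟ g)

sameNbhd-image : ∀ (G : Graph) {n} (f : Fin n → Fin (V G)) {x y} →
  SameNbhd G (colour (image? f)) x y ⇔ (∀ l → adj G (f l) x ≡ adj G (f l) y)
sameNbhd-image G f = mk⇔
  (λ sameNbhd l → sameNbhd (f l) (from (T-colour (image? f)) (l , refl)))
  (λ agree w w∈f → by-preimage (to (T-colour (image? f)) w∈f) agree)
  where
  by-preimage : ∀ {w x y} → ∃ (λ l → f l ≡ w) →
    (∀ l → adj G (f l) x ≡ adj G (f l) y) → adj G w x ≡ adj G w y
  by-preimage (l , refl) agree = agree l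

record RecognisesRows (G : Graph) {m : ℕ} (P : Fin m → Fin (V G) → Bool) (ψ : Formula m 2)
    {n : ℕ} (w : Fin n → Fin n → Fin (V G)) : Set where
  constructor recognises
  field
    sameRow⇔ : ∀ i j i′ j′ → Sat G P (pair (w i j) (w i′ j′)) ψ ⇔ (i ≡ i′)
open RecognisesRows

recognisesRows-restrict : ∀ {G : Graph} {m} {P : Fin m → Fin (V G) → Bool} {ψ} {n n′}
  {w : Fin n → Fin n → Fin (V G)} {ι : Fin n′ → Fin n} → (∀ {i i′} → ι i ≡ ι i′ → i ≡ i′) →
  RecognisesRows G P ψ w → RecognisesRows G P ψ (λ i j → w (ι i) (ι j))
recognisesRows-restrict ι-inj rows = recognises λ i j i′ j′ →
  mk⇔ (ι-inj ∘ to (sameRow⇔ rows _ _ _ _)) (from (sameRow⇔ rows _ _ _ _) ∘ cong _)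

-- Both endpoints climb one layer (lay zero) by a step; the new ones are the variables 1 and 0.
columnChain : ∀ {m} (cB cK : Fin m) (r : ℕ) → (Fin r → Fin m) → Formula m 2
columnChain cB cK ℕ.zero lay = same cB
columnChain cB cK (ℕ.suc r) lay =
  ∃f (∃f (pred (lay zero) (# 1) ∧f (pred (lay zero) (# 0) ∧f
    (step cK ⟨ # 2 , # 1 ⟩ ∧f (step cK ⟨ # 3 , # 0 ⟩ ∧f
      columnChain cB cK r (lay ∘ suc) ⟨ # 1 , # 0 ⟩)))))

-- v i j t plays the role of p_{i,j,t+1}: row i, column j, layer t.
record ColumnLayers (G : Graph) {m : ℕ} (P : Fin m → Fin (V G) → Bool) (cB cK : Fin m) {k : ℕ} (r : ℕ)
    (lay : Fin r → Fin m) (v : Fin k → Fin k → Fin (ℕ.suc r) → Fin (V G)) : Set where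
  field
    step-along-path : ∀ s i j → Step G (P cK) (v i j (inject₁ s)) (v i j (suc s))
    step-keeps-column : ∀ s i j i′ j′ → Step G (P cK) (v i j (inject₁ s)) (v i′ j′ (suc s)) → j ≡ j′
    layer-colour : ∀ s g → T (P (lay s) g) ⇔ (∃₂ λ i j → v i j (suc s) ≡ g)
    last-layer : ∀ i j i′ j′ → SameNbhd G (P cB) (v i j (fromℕ r)) (v i′ j′ (fromℕ r)) ⇔ (j ≡ j′)

module _ {G : Graph} {m : ℕ} {P : Fin m → Fin (V G) → Bool} {cB cK : Fin m} {k : ℕ} where

  dropFirstLayer : ∀ {r lay} {v : Fin k → Fin k → Fin (ℕ.suc (ℕ.suc r)) → Fin (V G)} →
    ColumnLayers G P cB cK (ℕ.suc r) lay v → ColumnLayers G P cB cK r (lay ∘ suc) (λ i j t → v i j (suc t))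
  dropFirstLayer L = record
    { step-along-path = step-along-path ∘ suc
    ; step-keeps-column = step-keeps-column ∘ suc
    ; layer-colour = layer-colour ∘ suc
    ; last-layer = last-layer
    }
    where open ColumnLayers L

  sat-columnChain : ∀ {r lay} {v : Fin k → Fin k → Fin (ℕ.suc r) → Fin (V G)} →
    ColumnLayers G P cB cK r lay v → RecognisesRows G P (columnChain cB cK r lay) (λ j i → v i j zero)
  sat-columnChain {ℕ.zero} L = recognises λ j i j′ i′ →
    ⇔.trans (sat-same G P cB _ _) (ColumnLayers.last-layer L i j i′ j′)
  sat-columnChain {ℕ.suc r} {lay} {v} L =
    recognises λ j i j′ i′ → mk⇔ (forward j i j′ i′) (backward j i j′ i′)
    where
    open ColumnLayers L
    chain = columnChain cB cK r (lay ∘ suc)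
    rest = sameRow⇔ (sat-columnChain (dropFirstLayer L))

    module _ (j i j′ i′ : Fin k) where
      x = v i j zero
      y = v i′ j′ zero

      env : Fin (V G) → Fin (V G) → Fin 4 → Fin (V G)
      env x₁ y₁ = extend y₁ (extend x₁ (pair x y))

      forward : Sat G P (pair x y) (columnChain cB cK (ℕ.suc r) lay) → j ≡ j′
      forward (x₁ , y₁ , x₁∈ , y₁∈ , x→x₁ , y→y₁ , chain₁)
        with to (layer-colour zero x₁) x₁∈ | to (layer-colour zero y₁) y₁∈
      ... | i₁ , j₁ , refl | i₂ , j₂ , refl = begin
        j  ≡⟨ step-keeps-column zero i j i₁ j₁
                (to (sat-step G P cK _ _) (to (sat-⟨⟩ G P (env x₁ y₁) (step cK) (# 2) (# 1)) x→x₁)) ⟩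
        j₁ ≡⟨ to (rest j₁ i₁ j₂ i₂) (to (sat-⟨⟩ G P (env x₁ y₁) chain (# 1) (# 0)) chain₁) ⟩
        j₂ ≡⟨ step-keeps-column zero i′ j′ i₂ j₂
                (to (sat-step G P cK _ _) (to (sat-⟨⟩ G P (env x₁ y₁) (step cK) (# 3) (# 0)) y→y₁)) ⟨
        j′ ∎
        where open ≡-Reasoning

      backward : j ≡ j′ → Sat G P (pair x y) (columnChain cB cK (ℕ.suc r) lay)
      backward refl =
        x₁ , y₁ ,
        from (layer-colour zero x₁) (i , j , refl) , from (layer-colour zero y₁) (i′ , j , refl) ,
        from (sat-⟨⟩ G P (env x₁ y₁) (step cK) (# 2) (# 1))
             (from (sat-step G P cK _ _) (step-along-path zero i j)) ,
        from (sat-⟨⟩ G P (env x₁ y₁) (step cK) (# 3) (# 0))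
             (from (sat-step G P cK _ _) (step-along-path zero i′ j)) ,
        from (sat-⟨⟩ G P (env x₁ y₁) chain (# 1) (# 0)) (from (rest j i j i′) refl)
        where
        x₁ = v i j (suc zero)
        y₁ = v i′ j (suc zero)

EdgeWitness : (H : Graph) {N : ℕ} → (Fin (V H) → Fin (V H) → Fin N) → Fin N → Set
EdgeWitness H w g = ∃₂ λ u v → T (adj H u v) × w u v ≡ g

edgeWitness? : (H : Graph) {N : ℕ} (w : Fin (V H) → Fin (V H) → Fin N) → ∀ g → Dec (EdgeWitness H w g)
edgeWitness? H w g = any? λ u → any? λ v → T? (adj H u v) ×-dec (w u v ≟ g)

encode : ∀ {m} → Fin m → Formula m 2 → Formula m 2 → Formula m 2
encode cM row col = ∃f (pred cM (# 0) ∧f (row ⟨ # 0 , # 1 ⟩ ∧f col ⟨ # 0 , # 2 ⟩))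

Interprets : ∀ {m} → Formula m 2 → Graph → Graph → Set
Interprets {m} φ G H = Σ (Fin m → Fin (V G) → Bool) λ P →
  EmbedsInduced (V G) (λ u v → eval G P (pair u v) φ ∨ eval G P (pair v u) φ) (Fin (V H)) (adj H)

module _ {G H : Graph} {m : ℕ} (P : Fin m → Fin (V G) → Bool) where

  interprets : ∀ φ (emb : Fin (V H) → Fin (V G)) → (∀ u v → emb u ≡ emb v → u ≡ v) →
    (∀ u v → Sat G P (pair (emb u) (emb v)) φ ⇔ T (adj H u v)) → Interprets φ G H
  interprets φ emb emb-inj defines = P , emb , emb-inj , λ u v _ → begin
    eval G P (pair (emb u) (emb v)) φ ∨ eval G P (pair (emb v) (emb u)) φ
      ≡⟨ cong₂ _∨_ (holds u v) (holds v u) ⟩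
    adj H u v ∨ adj H v u ≡⟨ cong (adj H u v ∨_) (Graph.sym H v u) ⟩
    adj H u v ∨ adj H u v ≡⟨ ∨-idem _ ⟩
    adj H u v             ∎
    where
    open ≡-Reasoning
    holds : ∀ u v → eval G P (pair (emb u) (emb v)) φ ≡ adj H u v
    holds u v = T-injective (⇔.trans (eval-sound G P _ φ) (defines u v))

  module _ {row col : Formula m 2} {w : Fin (V H) → Fin (V H) → Fin (V G)}
           (rows : RecognisesRows G P row w) (cols : RecognisesRows G P col (flip w)) where

    diagonal-injective : ∀ u v → w u u ≡ w v v → u ≡ v
    diagonal-injective u v eq = to (sameRow⇔ rows u u v v)
      (subst (λ z → Sat G P (pair (w u u) z) row) eq (from (sameRow⇔ rows u u u u) refl))

    sat-encode : ∀ {cM} → (∀ g → T (P cM g) ⇔ EdgeWitness H w g) →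
      ∀ u v → Sat G P (pair (w u u) (w v v)) (encode cM row col) ⇔ T (adj H u v)
    sat-encode {cM} marks u v = mk⇔ forward backward
      where
      env : Fin (V G) → Fin 3 → Fin (V G)
      env z = extend z (pair (w u u) (w v v))

      forward : Sat G P (pair (w u u) (w v v)) (encode cM row col) → T (adj H u v)
      forward (z , z∈M , z~x , z~y) with to (marks z) z∈M
      ... | u′ , v′ , u′v′ , refl = subst₂ (λ x y → T (adj H x y))
        (to (sameRow⇔ rows u′ v′ u u) (to (sat-⟨⟩ G P (env z) row (# 0) (# 1)) z~x))
        (to (sameRow⇔ cols v′ u′ v v) (to (sat-⟨⟩ G P (env z) col (# 0) (# 2)) z~y))
        u′v′

      backward : T (adj H u v) → Sat G P (pair (w u u) (w v v)) (encode cM row col)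
      backward uv = w u v , from (marks (w u v)) (u , v , uv , refl) ,
        from (sat-⟨⟩ G P (env (w u v)) row (# 0) (# 1)) (from (sameRow⇔ rows u v u u) refl) ,
        from (sat-⟨⟩ G P (env (w u v)) col (# 0) (# 2)) (from (sameRow⇔ cols v u v v) refl)

    interprets-encodeˡ : ∀ cM ψ → (∀ {x y} → ¬ Sat G P (pair x y) ψ) →
      (∀ g → T (P cM g) ⇔ EdgeWitness H w g) →
      Interprets (encode cM row col ∨f ψ) G H
    interprets-encodeˡ cM ψ ψ-unsat marks = interprets (encode cM row col ∨f ψ) (λ u → w u u) diagonal-injective
      λ u v → ⇔.trans (mk⇔ [ (λ s → s) , ⊥-elim ∘ ψ-unsat ] inj₁) (sat-encode marks u v)

    interprets-encodeʳ : ∀ cM ψ → (∀ {x y} → ¬ Sat G P (pair x y) ψ) →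
      (∀ g → T (P cM g) ⇔ EdgeWitness H w g) →
      Interprets (ψ ∨f encode cM row col) G H
    interprets-encodeʳ cM ψ ψ-unsat marks = interprets (ψ ∨f encode cM row col) (λ u → w u u) diagonal-injective
      λ u v → ⇔.trans (mk⇔ [ ⊥-elim ∘ ψ-unsat , (λ s → s) ] inj₂) (sat-encode marks u v)

rowMarker colMarker flipMarker crossingEdges gridEdges : ∀ {r′} → Fin (5 ℕ.+ r′)
rowMarker = # 0
colMarker = # 1
flipMarker = # 2
crossingEdges = # 3
gridEdges = # 4

layerColour : ∀ {r′} → Fin r′ → Fin (5 ℕ.+ r′)
layerColour s = 5 ↑ʳ s

crossingFormula gridFormula transducer : (r′ : ℕ) → Formula (5 ℕ.+ r′) 2
crossingFormula r′ = encode crossingEdges (same rowMarker) (columnChain colMarker flipMarker r′ layerColour)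
gridFormula r′ = encode gridEdges (same rowMarker) (same colMarker)
transducer r′ = crossingFormula r′ ∨f gridFormula r′

module _ {r′ : ℕ} where

  isLast-fromℕ : isLast (fromℕ r′) ≡ true
  isLast-fromℕ = to T-≡ (≡⇒≡ᵇ _ _ (toℕ-fromℕ r′))

  isLast-inject₁ : (s : Fin r′) → isLast (inject₁ s) ≡ false
  isLast-inject₁ s = ¬T⇒≡false (toℕ-inject₁-≢ s ∘ sym ∘ ≡ᵇ⇒≡ _ _)

  T-∧isLast : ∀ {x} → T (x ∧ isLast (fromℕ r′)) ⇔ T x
  T-∧isLast {x} = T-cong (trans (cong (x ∧_) isLast-fromℕ) (∧-identityʳ x))

  pathE-up : ∀ {k} (i j i′ j′ : Fin k) (s : Fin r′) →
    pathE i j (inject₁ s) i′ j′ (suc s) ≡ (i == i′) ∧ (j == j′)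
  pathE-up i j i′ j′ s =
    trans (cong (λ z → (i == i′) ∧ ((j == j′) ∧ z)) (to T-≡ (≡⇒≡ᵇ _ _ (toℕ-inject₁ s))))
          (cong ((i == i′) ∧_) (∧-identityʳ (j == j′)))

  pathE-down : ∀ {k} (i j i′ j′ : Fin k) (s : Fin r′) →
    pathE i′ j′ (suc s) i j (inject₁ s) ≡ false
  pathE-down i j i′ j′ s =
    trans (cong (λ z → (i′ == i) ∧ ((j′ == j) ∧ z))
                (¬T⇒≡false λ t →
                  m≢1+n+m (toℕ s) {1} (trans (sym (toℕ-inject₁ s)) (sym (≡ᵇ⇒≡ _ _ t)))))
          (trans (cong ((i′ == i) ∧_) (∧-zeroʳ (j′ == j))) (∧-zeroʳ (i′ == i)))

record CrossingAxioms {k r′ : ℕ} (c : CrossV k (ℕ.suc r′) → CrossV k (ℕ.suc r′) → Bool) : Set where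
  field
    a-rows : ∀ i j i′ j′ → (∀ l → c (a l) (p i j zero) ≡ c (a l) (p i′ j′ zero)) ⇔ (i ≡ i′)
    b-columns : ∀ i j i′ j′ →
      (∀ l → c (b l) (p i j (fromℕ r′)) ≡ c (b l) (p i′ j′ (fromℕ r′))) ⇔ (j ≡ j′)
    path : ∀ s i j → T (c (p i j (inject₁ s)) (p i j (suc s)))
    path-keeps-column : ∀ s i j i′ j′ → T (c (p i j (inject₁ s)) (p i′ j′ (suc s))) → j ≡ j′

module _ {k r′ : ℕ} where

  private
    R = ℕ.suc r′

  star-consecutive : ∀ (i j i′ j′ : Fin k) (s : Fin r′) →
    starCrossing k R (p i j (inject₁ s)) (p i′ j′ (suc s)) ≡ (i == i′) ∧ (j == j′)
  star-consecutive i j i′ j′ s =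
    trans (cong₂ _∨_ (pathE-up i j i′ j′ s) (pathE-down i j i′ j′ s)) (∨-identityʳ _)

  -- The extra clique edges lie inside the first and inside the last layer.
  clique-consecutive : ∀ (i j i′ j′ : Fin k) (s : Fin r′) →
    cliqueCrossing k R (p i j (inject₁ s)) (p i′ j′ (suc s))
      ≡ starCrossing k R (p i j (inject₁ s)) (p i′ j′ (suc s))
  clique-consecutive i j i′ j′ s rewrite isLast-inject₁ s
    | ∧-zeroʳ (isFirst (inject₁ s)) | ∧-zeroʳ (isLast {R} (suc s))
    | ∨-identityʳ (pathE i j (inject₁ s) i′ j′ (suc s))
    | ∨-identityʳ (pathE i′ j′ (suc s) i j (inject₁ s)) = refl

  T-star-consecutive : ∀ (i j i′ j′ : Fin k) (s : Fin r′) →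
    T (starCrossing k R (p i j (inject₁ s)) (p i′ j′ (suc s))) ⇔ (i ≡ i′ × j ≡ j′)
  T-star-consecutive i j i′ j′ s =
    ⇔.trans (T-cong (star-consecutive i j i′ j′ s)) (⇔.trans T-∧ (T-== ×-⇔ T-==))

  starAxioms : CrossingAxioms (starCrossing k R)
  starAxioms = record
    { a-rows = λ i j i′ j′ → mk⇔
        (markers-separate refl (λ i≡i′ _ → i≡i′) (λ l i → ((l == i) ∧ true) ∨ false)
                          (λ _ _ → ⇔.trans T-∧true∨false T-==))
        (λ { refl _ → refl })
    ; b-columns = λ i j i′ j′ → mk⇔
        (markers-separate refl (λ j≡l _ → sym j≡l) (λ l j → (j == l) ∧ isLast (fromℕ r′))
                          (λ _ _ → ⇔.trans (T-∧isLast {r′}) T-==))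
        (λ { refl _ → refl })
    ; path = λ s i j → from (T-star-consecutive i j i j s) (refl , refl)
    ; path-keeps-column = λ s i j i′ j′ → proj₂ ∘ to (T-star-consecutive i j i′ j′ s)
    }

  cliqueAxioms : CrossingAxioms (cliqueCrossing k R)
  cliqueAxioms = record
    { a-rows = a-rows
    ; b-columns = b-columns
    ; path = λ s i j → subst T (sym (clique-consecutive i j i j s)) (path s i j)
    ; path-keeps-column = λ s i j i′ j′ →
        path-keeps-column s i j i′ j′ ∘ subst T (clique-consecutive i j i′ j′ s)
    }
    where open CrossingAxioms starAxioms

  halfAxioms : CrossingAxioms (halfCrossing k R)
  halfAxioms = record
    { a-rows = λ i j i′ j′ → mk⇔
        (markers-separate Fin.≤-refl Fin.≤-antisym (λ l i → ((l <= i) ∧ true) ∨ false)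
                          (λ _ _ → ⇔.trans T-∧true∨false T-<=))
        (λ { refl _ → refl })
    ; b-columns = λ i j i′ j′ → mk⇔
        (markers-separate Fin.≤-refl Fin.≤-antisym (λ l j → (l <= j) ∧ isLast (fromℕ r′))
                          (λ _ _ → ⇔.trans (T-∧isLast {r′}) T-<=))
        (λ { refl _ → refl })
    ; path = path
    ; path-keeps-column = path-keeps-column
    }
    where open CrossingAxioms starAxioms

p-layer-injective : ∀ {n r} {i j i′ j′ : Fin n} {t t′ : Fin r} → p i j t ≡ p i′ j′ t′ → t ≡ t′
p-layer-injective refl = refl

module FlippedCrossing (H : Graph) {G : Graph} {r′ : ℕ}
  {c : CrossV (ℕ.suc (V H)) (ℕ.suc r′) → CrossV (ℕ.suc (V H)) (ℕ.suc r′) → Bool}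
  (axioms : CrossingAxioms c)
  (F : Fin (3 ℕ.+ r′) → Fin (3 ℕ.+ r′) → Bool)
  (e : CrossV (ℕ.suc (V H)) (ℕ.suc r′) → Fin (V G))
  (e-inj : ∀ u v → e u ≡ e v → u ≡ v)
  (e-adj : ∀ u v → ¬ u ≡ v → adj G (e u) (e v) ≡ flipLayers F c u v)
  where

  open CrossingAxioms axioms

  k : ℕ
  k = ℕ.suc (V H)

  pLayer : Fin (ℕ.suc r′) → Fin (3 ℕ.+ r′)
  pLayer t = suc (inject₁ t)

  flipAbove : Fin r′ → Bool
  flipAbove s = F (pLayer (inject₁ s)) (pLayer (suc s))

  InLayer : Fin (ℕ.suc r′) → Fin (V G) → Set
  InLayer t g = ∃₂ λ i j → e (p i j t) ≡ g

  inLayer? : ∀ t g → Dec (InLayer t g)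
  inLayer? t g = any? λ i → any? λ j → e (p i j t) ≟ g

  FlipsAbove : Fin (V G) → Set
  FlipsAbove g = ∃ λ s → InLayer (inject₁ s) g × T (flipAbove s)

  flipsAbove? : ∀ g → Dec (FlipsAbove g)
  flipsAbove? g = any? λ s → inLayer? (inject₁ s) g ×-dec T? (flipAbove s)

  witness : Fin (V H) → Fin (V H) → Fin (V G)
  witness u v = e (p (suc u) (suc v) zero)

  P : Fin (5 ℕ.+ r′) → Fin (V G) → Bool
  P = colour (image? (e ∘ a)) ∷ colour (image? (e ∘ b)) ∷ colour flipsAbove? ∷ colour (edgeWitness? H witness)
    ∷ (λ _ → false) ∷ (λ s → colour (inLayer? (suc s)))

  agree-on-marker : ∀ u {i j i′ j′ t} → (∀ {i j} → ¬ u ≡ p i j t) →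
    (adj G (e u) (e (p i j t)) ≡ adj G (e u) (e (p i′ j′ t))) ⇔ (c u (p i j t) ≡ c u (p i′ j′ t))
  agree-on-marker u u∉p = mk⇔
    (λ eq → xor-cancelʳ _ (trans (sym (e-adj _ _ u∉p)) (trans eq (e-adj _ _ u∉p))))
    (λ eq → trans (e-adj _ _ u∉p) (trans (cong (_xor _) eq) (sym (e-adj _ _ u∉p))))

  markers-agree : ∀ (f : Fin k → CrossV k (ℕ.suc r′)) {i j i′ j′ t} → (∀ l {i j} → ¬ f l ≡ p i j t) →
    SameNbhd G (colour (image? (e ∘ f))) (e (p i j t)) (e (p i′ j′ t))
      ⇔ (∀ l → c (f l) (p i j t) ≡ c (f l) (p i′ j′ t))
  markers-agree f f∉p = ⇔.trans (sameNbhd-image G (e ∘ f)) (∀-⇔ λ l → agree-on-marker (f l) (f∉p l))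

  flip-colour : ∀ i j s → P flipMarker (e (p i j (inject₁ s))) ≡ flipAbove s
  flip-colour i j s = T-injective (⇔.trans (T-colour flipsAbove?) (mk⇔ same-layer (λ f → s , (i , j , refl) , f)))
    where
    same-layer : FlipsAbove (e (p i j (inject₁ s))) → T (flipAbove s)
    same-layer (s′ , (i′ , j′ , eq) , f) =
      subst (T ∘ flipAbove) (inject₁-injective (p-layer-injective (e-inj _ _ eq))) f

  step-is-path-edge : ∀ i j i′ j′ s → Step G (P flipMarker) (e (p i j (inject₁ s))) (e (p i′ j′ (suc s)))
                                       ⇔ T (c (p i j (inject₁ s)) (p i′ j′ (suc s)))
  step-is-path-edge i j i′ j′ s = T-cong (begin
    adj G (e x) (e y) xor P flipMarker (e x) ≡⟨ cong₂ _xor_ (e-adj x y x≢y) (flip-colour i j s) ⟩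
    (c x y xor flipAbove s) xor flipAbove s  ≡⟨ xor-twice (c x y) (flipAbove s) ⟩
    c x y                                    ∎)
    where
    open ≡-Reasoning
    x = p i j (inject₁ s)
    y = p i′ j′ (suc s)
    x≢y : ¬ x ≡ y
    x≢y eq = 1+n≢n (sym (trans (sym (toℕ-inject₁ s)) (cong toℕ (p-layer-injective eq))))

  columnLayers : ColumnLayers G P colMarker flipMarker r′ layerColour (λ i j t → e (p i j t))
  columnLayers = record
    { step-along-path = λ s i j → from (step-is-path-edge i j i j s) (path s i j)
    ; step-keeps-column = λ s i j i′ j′ →
        path-keeps-column s i j i′ j′ ∘ to (step-is-path-edge i j i′ j′ s)
    ; layer-colour = λ s g → T-colour (inLayer? (suc s))
    ; last-layer = λ i j i′ j′ → ⇔.trans (markers-agree b λ _ ()) (b-columns i j i′ j′)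
    }

  rows : RecognisesRows G P (same rowMarker) (λ i j → e (p i j zero))
  rows = recognises λ i j i′ j′ →
    ⇔.trans (sat-same G P rowMarker _ _) (⇔.trans (markers-agree a λ _ ()) (a-rows i j i′ j′))

  crossing-interprets : Interprets (transducer r′) G H
  crossing-interprets = interprets-encodeˡ {H = H} P
    (recognisesRows-restrict suc-injective rows)
    (recognisesRows-restrict suc-injective (sat-columnChain columnLayers))
    crossingEdges (gridFormula r′) (λ { (_ , () , _) }) (λ _ → T-colour (edgeWitness? H witness))

module Grid (H : Graph) {G : Graph} {r′ : ℕ}
  (e : Fin (ℕ.suc (V H)) × Fin (ℕ.suc (V H)) → Fin (V G))
  (e-adj : ∀ u v → ¬ u ≡ v → adj G (e u) (e v) ≡ gridAdj (ℕ.suc (V H)) u v)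
  where

  k : ℕ
  k = ℕ.suc (V H)

  witness : Fin (V H) → Fin (V H) → Fin (V G)
  witness u v = e (suc u , suc v)

  P : Fin (5 ℕ.+ r′) → Fin (V G) → Bool
  P = colour (image? λ t → e (suc t , zero)) ∷ colour (image? λ t → e (zero , suc t)) ∷ (λ _ → false)
    ∷ (λ _ → false) ∷ colour (edgeWitness? H witness) ∷ (λ _ _ → false)

  agree-on-marker : ∀ u {x y} → ¬ u ≡ x → ¬ u ≡ y →
    (adj G (e u) (e x) ≡ adj G (e u) (e y)) ⇔ (gridAdj k u x ≡ gridAdj k u y)
  agree-on-marker u u≢x u≢y = mk⇔
    (λ eq → trans (sym (e-adj _ _ u≢x)) (trans eq (e-adj _ _ u≢y)))
    (λ eq → trans (e-adj _ _ u≢x) (trans eq (sym (e-adj _ _ u≢y))))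

  -- gridAdj k (suc t , zero) (suc i , suc j) reduces to the mark below, which ignores j;
  -- dually for columns.
  rows : RecognisesRows G P (same rowMarker) witness
  rows = recognises λ i j i′ j′ → ⇔.trans (sat-same G P rowMarker _ _) (⇔.trans (sameNbhd-image G _)
    (⇔.trans (∀-⇔ λ t → agree-on-marker (suc t , zero) (λ ()) (λ ()))
      (mk⇔ (markers-separate Fin.≤-refl Fin.≤-antisym (λ t i → (t == i) ∨ not ((t << i) xor true)) rowMark)
           (λ { refl _ → refl }))))
    where
    rowMark : ∀ t i → T ((t == i) ∨ not ((t << i) xor true)) ⇔ (t Fin.≤ i)
    rowMark t i = ⇔.trans (T-cong (cong ((t == i) ∨_) (not-xor-true (t << i)))) T-==∨<<

  columns : RecognisesRows G P (same colMarker) (flip witness)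
  columns = recognises λ j i j′ i′ → ⇔.trans (sat-same G P colMarker _ _) (⇔.trans (sameNbhd-image G _)
    (⇔.trans (∀-⇔ λ t → agree-on-marker (zero , suc t) (λ ()) (λ ()))
      (mk⇔ (markers-separate Fin.≤-refl Fin.≤-antisym (λ t j → (t == j) ∨ not (not (t << j))) colMark)
           (λ { refl _ → refl }))))
    where
    colMark : ∀ t j → T ((t == j) ∨ not (not (t << j))) ⇔ (t Fin.≤ j)
    colMark t j = ⇔.trans (T-cong (cong ((t == j) ∨_) (not-involutive (t << j)))) T-==∨<<

  grid-interprets : Interprets (transducer r′) G H
  grid-interprets = interprets-encodeʳ {H = H} P rows columns
    gridEdges (crossingFormula r′) (λ { (_ , () , _) }) (λ _ → T-colour (edgeWitness? H witness))

-- Patterns of order |V H| + 1 are used because a grid spends its row and column 0 on markers.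
pattern-interprets : ∀ H {G : Graph} {r′} →
  ContainsPattern G (ℕ.suc r′) (ℕ.suc (V H)) → Interprets (transducer r′) G H
pattern-interprets H (inj₁ (F , _ , e , e-inj , e-adj)) =
  FlippedCrossing.crossing-interprets H starAxioms F e e-inj e-adj
pattern-interprets H (inj₂ (inj₁ (F , _ , e , e-inj , e-adj))) =
  FlippedCrossing.crossing-interprets H cliqueAxioms F e e-inj e-adj
pattern-interprets H (inj₂ (inj₂ (inj₁ (F , _ , e , e-inj , e-adj)))) =
  FlippedCrossing.crossing-interprets H halfAxioms F e e-inj e-adj
pattern-interprets H (inj₂ (inj₂ (inj₂ (e , _ , e-adj)))) =
  Grid.grid-interprets H e e-adj

proposition12p22 : (𝒞 : GraphClass) (r : ℕ) → 1 ≤ r →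
    (∀ (k : ℕ) → Σ Graph (λ G → 𝒞 G × ContainsPattern G r k)) →
    MonadicallyIndependent 𝒞
proposition12p22 𝒞 ℕ.zero () patterns
proposition12p22 𝒞 (ℕ.suc r′) _ patterns = 5 ℕ.+ r′ , transducer r′ , interpret
  where
  interpret : ∀ H → AllGraphs H → Σ Graph λ G → 𝒞 G × Interprets (transducer r′) G H
  interpret H _ with patterns (ℕ.suc (V H))
  ... | G , G∈𝒞 , G⊇pattern = G , G∈𝒞 , pattern-interprets H G⊇pattern
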